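{- The following claim is false: "For every complete theory $T$, every formula $\varphi(x;y)$ and every $k\ge 2$, if $\varphi(x;y)$ witnesses $k$-TP with some s-indiscernible parameters $\{a_\eta\mid\eta\in{}^{\omega>}\omega\}$, then for any str-indiscernible set $\{b_\eta\mid\eta\in{}^{\omega>}\omega\}$ that is str-based on $\{a_\eta\}$, the formula $\varphi(x;y)$ and $\{b_\eta\}$ witness $k'$-TP for some $k'$." In fact, there are a complete theory $T$, a formula $\varphi(x;y)$, s-indiscernible parameters $\{a_\eta\mid\eta\in{}^{\omega>}\omega\}$ with which $\varphi$ witnesses $2$-TP, and a str-indiscernible set $\{b_\eta\mid\eta\in{}^{\omega>}\omega\}$ str-based on $\{a_\eta\}$ such that $\varphi$ and $\{b_\eta\}$ do not witness $k'$-TP for any $k'$.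
   Context: On ${}^{\omega>}\omega$ ($\ell(\eta)$ = length): $\unlhd$ initial segment, $\wedge$ meet, $<_{lex}$ lexicographic order (proper initial segments smaller), $P_\alpha(\eta)\iff\ell(\eta)=\alpha$, $\eta<_{len}\nu\iff\ell(\eta)<\ell(\nu)$; $L_s=\{\unlhd,\wedge,<_{lex},(P_\alpha)_{\alpha<\omega}\}$, $L_{str}=\{\unlhd,\wedge,<_{lex},<_{len}\}$. For $s'\in\{s,str\}$, $\{b_\eta\}$ is $s'$-indiscernible if finite index tuples with the same quantifier-free $L_{s'}$-type give parameter tuples with the same complete type in the monster model; $B=\{b_\eta\}$ is $s'$-based on $A=\{a_\nu\}$ if for every formula $\varphi$ and finite $(\eta_1,\dots,\eta_n)$ there is $(\nu_1,\dots,\nu_n)$ with the same quantifier-free $L_{s'}$-type such that $\varphi(b_{\eta_1},\dots,b_{\eta_n})$ holds iff $\varphi(a_{\nu_1},\dots,a_{\nu_n})$ holds. $\varphi(x;y)$ witnesses $k$-TP with $\{a_\eta\}$ if $\{\varphi(x,a_{\mu\upharpoonright n}):n<\omega\}$ is consistent for each $\mu\in{}^\omega\omega$ and $\{\varphi(x,a_{\eta_j}):j<k\}$ is inconsistent for any siblings $\eta_0,\dots,\eta_{k-1}$ (distinct $\nu^\frown\langle t_j\rangle$ with a common $\nu$). -}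

module Defs where

open import Data.Nat using (ℕ; zero; suc; _<_)
open import Data.Nat.Properties using (_≟_)
open import Data.Fin using (Fin)
open import Data.List using (List; []; _∷_; _++_; length; applyUpTo)
open import Data.List.Relation.Unary.All using (All)
open import Data.Product using (Σ; ∃; _×_; _,_)
open import Data.Sum using (_⊎_; inj₁; inj₂)
open import Data.Maybe using (Maybe; just; nothing; maybe)
open import Data.Empty using (⊥)
open import Relation.Nullary using (¬_; yes; no)
open import Relation.Binary.PropositionalEquality using (_≡_)
open import Function.Bundles using (_⇔_)
open import Function.Definitions using (Injective)

Tree : Set
Tree = List ℕ

data _⊴_ : Tree → Tree → Set where
  []⊴  : ∀ {ν} → [] ⊴ ν
  ∷⊴   : ∀ {x η ν} → η ⊴ ν → (x ∷ η) ⊴ (x ∷ ν)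

_∧ₜ_ : Tree → Tree → Tree
[] ∧ₜ _ = []
(_ ∷ _) ∧ₜ [] = []
(x ∷ η) ∧ₜ (y ∷ ν) with x ≟ y
... | yes _ = x ∷ (η ∧ₜ ν)
... | no _  = []

data _<lex_ : Tree → Tree → Set where
  []<  : ∀ {y ν} → [] <lex (y ∷ ν)
  hd<  : ∀ {x y η ν} → x < y → (x ∷ η) <lex (y ∷ ν)
  tl<  : ∀ {x η ν} → η <lex ν → (x ∷ η) <lex (x ∷ ν)

-- terms of the index languages (variables closed under meet)
data TTerm (n : ℕ) : Set where
  tvar  : Fin n → TTerm n
  tmeet : TTerm n → TTerm n → TTerm n

evalT : ∀ {n} → (Fin n → Tree) → TTerm n → Tree
evalT η (tvar i) = η i
evalT η (tmeet t u) = evalT η t ∧ₜ evalT η u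

-- Same quantifier-free L_s-type (L_s = {⊴, ∧, <lex, (P_α)_α}, with =):
-- agreement on all atomic formulas (qf formulas are boolean combinations).
SameQF-s : ∀ {n} → (Fin n → Tree) → (Fin n → Tree) → Set
SameQF-s {n} η ν = (t u : TTerm n) →
    ((evalT η t ≡ evalT η u) ⇔ (evalT ν t ≡ evalT ν u))
  × ((evalT η t ⊴ evalT η u) ⇔ (evalT ν t ⊴ evalT ν u))
  × ((evalT η t <lex evalT η u) ⇔ (evalT ν t <lex evalT ν u))
  × ((α : ℕ) → (length (evalT η t) ≡ α) ⇔ (length (evalT ν t) ≡ α))

-- Same quantifier-free L_str-type (L_str = {⊴, ∧, <lex, <len}, with =)
SameQF-str : ∀ {n} → (Fin n → Tree) → (Fin n → Tree) → Set
SameQF-str {n} η ν = (t u : TTerm n) →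
    ((evalT η t ≡ evalT η u) ⇔ (evalT ν t ≡ evalT ν u))
  × ((evalT η t ⊴ evalT η u) ⇔ (evalT ν t ⊴ evalT ν u))
  × ((evalT η t <lex evalT η u) ⇔ (evalT ν t <lex evalT ν u))
  × ((length (evalT η t) < length (evalT η u)) ⇔ (length (evalT ν t) < length (evalT ν u)))

data IndexLang : Set where
  s str : IndexLang

SameQF : IndexLang → ∀ {n} → (Fin n → Tree) → (Fin n → Tree) → Set
SameQF s   = SameQF-s
SameQF str = SameQF-str

record Signature : Set₁ where
  field
    Func : ℕ → Set
    Rel  : ℕ → Set

record Structure (L : Signature) : Set₁ where
  open Signature L
  field
    Carrier : Set
    funI    : ∀ {k} → Func k → (Fin k → Carrier) → Carrier
    relI    : ∀ {k} → Rel k → (Fin k → Carrier) → Set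

module _ (L : Signature) where
  open Signature L

  data Term (V : Set) : Set where
    var : V → Term V
    app : ∀ {k} → Func k → (Fin k → Term V) → Term V

  data Formula (V : Set) : Set where
    rel    : ∀ {k} → Rel k → (Fin k → Term V) → Formula V
    equal  : Term V → Term V → Formula V
    falsum : Formula V
    neg    : Formula V → Formula V
    conj   : Formula V → Formula V → Formula V
    disj   : Formula V → Formula V → Formula V
    exists : Formula (Maybe V) → Formula V
    univ : Formula (Maybe V) → Formula V

module _ {L : Signature} (M : Structure L) where
  open Structure M

  evalTerm : ∀ {V} → (V → Carrier) → Term L V → Carrier
  evalTerm ρ (var v) = ρ v
  evalTerm ρ (app f ts) = funI f (λ i → evalTerm ρ (ts i))

  Sat : ∀ {V} → Formula L V → (V → Carrier) → Set
  Sat (rel r ts) ρ = relI r (λ i → evalTerm ρ (ts i))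
  Sat (equal t u) ρ = evalTerm ρ t ≡ evalTerm ρ u
  Sat falsum ρ = ⊥
  Sat (neg ψ) ρ = ¬ Sat ψ ρ
  Sat (conj ψ χ) ρ = Sat ψ ρ × Sat χ ρ
  Sat (disj ψ χ) ρ = Sat ψ ρ ⊎ Sat χ ρ
  Sat (exists ψ) ρ = Σ Carrier λ c → Sat ψ (maybe ρ c)
  Sat (univ ψ) ρ = (c : Carrier) → Sat ψ (maybe ρ c)

  Family : ℕ → Set
  Family l = Tree → Fin l → Carrier

  tupleVal : ∀ {l n} → Family l → (Fin n → Tree) → Fin n × Fin l → Carrier
  tupleVal a η (i , j) = a (η i) j

  Indiscernible : IndexLang → ∀ {l} → Family l → Set
  Indiscernible s' {l} a = ∀ n (η ν : Fin n → Tree) → SameQF s' η ν →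
    (ψ : Formula L (Fin n × Fin l)) → Sat ψ (tupleVal a η) ⇔ Sat ψ (tupleVal a ν)

  BasedOn : IndexLang → ∀ {l} → Family l → Family l → Set
  BasedOn s' {l} b a = ∀ n (ψ : Formula L (Fin n × Fin l)) (η : Fin n → Tree) →
    Σ (Fin n → Tree) λ ν → SameQF s' η ν × (Sat ψ (tupleVal b η) ⇔ Sat ψ (tupleVal a ν))

  xyVal : ∀ {m l} → (Fin m → Carrier) → (Fin l → Carrier) → Fin m ⊎ Fin l → Carrier
  xyVal x c (inj₁ i) = x i
  xyVal x c (inj₂ j) = c j

  restrict : (ℕ → ℕ) → ℕ → Tree
  restrict μ n = applyUpTo μ n

  -- φ(x;y) with |x| = m, |y| = l witnesses k-TP with {a_η}.
  -- Consistency of a partial type over parameters in M (M ⊨ Th(M), a complete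
  -- theory) = finite satisfiability in M.
  WitnessesTP : ∀ {m l} → Formula L (Fin m ⊎ Fin l) → ℕ → Family l → Set
  WitnessesTP {m} {l} φ k a =
      ((μ : ℕ → ℕ) (ns : List ℕ) →
         Σ (Fin m → Carrier) λ x → All (λ n → Sat φ (xyVal x (a (restrict μ n)))) ns)
    × ((ν : Tree) (t : Fin k → ℕ) → Injective _≡_ _≡_ t →
         ¬ (Σ (Fin m → Carrier) λ x → (j : Fin k) → Sat φ (xyVal x (a (ν ++ (t j ∷ []))))))

module Submission where

-- The model M consists of keys, values and finite partial functions from keys
-- to values ("graphs"), with the single relation Maps(g, k, v) ⟺ g(k) = v;
-- keys are the elements of Maybe Tree, values are trees.  The formula is
-- φ(x; y₀y₁) = Maps(x, y₀, y₁) and the parameter families are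
--     a_η = (parent η, η)        b_η = (η, η)
-- where parent η is the immediate predecessor of η (nothing for the root).
-- Along a branch the keys parent(μ↾n) are distinct, so a graph realises all of
-- φ(x, a_{μ↾n}); two siblings share their parent, so no function sends it to
-- both: φ witnesses 2-TP with {a_η}.  With {b_η}, the identity graph on the
-- children of the root realises every sibling set, so there is no k-TP.
--
-- Indiscernibility is proved by homogeneity: every pair of permutations of keys
-- and of values induces an automorphism of M, automorphisms preserve
-- satisfaction, and two tuples with the same equality pattern are conjugate by
-- a permutation.  So a tuple of a_η's (resp. b_η's) is determined up to
-- automorphism by the equality patterns of its keys and values, which is fixed
-- by the qf L_s-type (resp. the qf L_str-type) of the indices.  For basedness
-- we use the map dbl η = ⟨η₀,0,η₁,0,…⟩, which preserves qf L_str-types and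
-- makes parent ∘ dbl injective, so b_η and a_{dbl η} have the same patterns.

open import Defs
open import Data.Nat using (ℕ; zero; suc; _<_; _≤_; _*_; z≤n; s≤s)
open import Data.Nat.Properties using (_≟_; suc-injective; *-suc; *-monoʳ-<; *-cancelˡ-<)
open import Data.Fin using (Fin; zero; suc; toℕ)
open import Data.Fin.Properties using (toℕ-injective; any?; 0≢1+n)
open import Data.List using (List; []; _∷_; _∷ʳ_; length; map; allFin)
open import Data.List.Properties using (∷-injectiveˡ; ∷-injectiveʳ; ∷ʳ-injectiveʳ; length-applyUpTo)
import Data.List.Properties as List
open import Data.List.Membership.Propositional using (_∈_)
open import Data.List.Membership.Propositional.Properties using (∈-map⁺; ∈-allFin)
import Data.List.Relation.Unary.All as All
open import Data.List.Relation.Unary.Any using (here; there)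
open import Data.Maybe using (Maybe; just; nothing; maybe; fromMaybe)
import Data.Maybe as Maybe
open import Data.Maybe.Properties using (just-injective)
import Data.Maybe.Properties as Maybeₚ
open import Data.Product using (Σ; _×_; _,_; proj₁; proj₂)
import Data.Product as Product
open import Data.Product.Function.NonDependent.Propositional using (_×-⇔_)
open import Data.Sum using (_⊎_; inj₁; inj₂)
open import Data.Sum.Function.Propositional using (_⊎-⇔_)
open import Data.Empty using (⊥; ⊥-elim)
open import Function.Base using (_∘_; id)
open import Function.Bundles using (_⇔_; mk⇔; _↔_; mk↔ₛ′; Inverse; Equivalence; Injection)
open import Function.Definitions using (Injective)
open import Function.Properties.Inverse using (Inverse⇒Injection; ↔-refl; ↔-trans)
open import Function.Properties.Equivalence using (⇔-isEquivalence)
open import Function.Related.TypeIsomorphisms using (¬-cong-⇔)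
open import Level using (0ℓ)
open import Relation.Binary.Definitions using (DecidableEquality)
open import Relation.Binary.Structures using (IsEquivalence)
open import Relation.Binary.PropositionalEquality
open import Relation.Nullary using (¬_; yes; no)

module ⇔ = IsEquivalence (⇔-isEquivalence {0ℓ})
open Equivalence using (to; from)

↔-injective : {A : Set} (π : A ↔ A) → Injective _≡_ _≡_ (Inverse.to π)
↔-injective π = Injection.injective (Inverse⇒Injection π)


module _ {L : Signature} (M : Structure L) where
  open Signature L
  open Structure M

  -- A permutation of the carrier commuting with all symbols.  Commutation is
  -- stated for argument tuples that agree pointwise, avoiding extensionality.
  record IsAutomorphism (π : Carrier ↔ Carrier) : Set where
    field
      preserves-fun : ∀ {k} (f : Func k) (xs ys : Fin k → Carrier) →
        (∀ i → ys i ≡ Inverse.to π (xs i)) → funI f ys ≡ Inverse.to π (funI f xs)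
      preserves-rel : ∀ {k} (r : Rel k) (xs ys : Fin k → Carrier) →
        (∀ i → ys i ≡ Inverse.to π (xs i)) → relI r xs ⇔ relI r ys

  module _ (π : Carrier ↔ Carrier) (auto : IsAutomorphism π) where
    open Inverse π using () renaming (to to σ; from to σ⁻¹; strictlyInverseˡ to σσ⁻¹)
    open IsAutomorphism auto

    Image : ∀ {V} → (V → Carrier) → (V → Carrier) → Set
    Image ρ ρ′ = ∀ v → ρ′ v ≡ σ (ρ v)

    evalTerm-image : ∀ {V} {ρ ρ′ : V → Carrier} → Image ρ ρ′ →
      (t : Term L V) → evalTerm M ρ′ t ≡ σ (evalTerm M ρ t)
    evalTerm-image h (var v) = h v
    evalTerm-image h (app f ts) = preserves-fun f _ _ (λ i → evalTerm-image h (ts i))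

    image-under-binder : ∀ {V} {ρ ρ′ : V → Carrier} → Image ρ ρ′ →
      ∀ c → Image (maybe ρ c) (maybe ρ′ (σ c))
    image-under-binder h c (just v) = h v
    image-under-binder h c nothing = refl

    ≡-image : ∀ {x y x′ y′} → x′ ≡ σ x → y′ ≡ σ y → (x ≡ y) ⇔ (x′ ≡ y′)
    ≡-image refl refl = mk⇔ (cong σ) (↔-injective π)

    Sat-invariant : ∀ {V} (ψ : Formula L V) {ρ ρ′ : V → Carrier} → Image ρ ρ′ →
      Sat M ψ ρ ⇔ Sat M ψ ρ′
    Sat-invariant (rel r ts) h = preserves-rel r _ _ (λ i → evalTerm-image h (ts i))
    Sat-invariant (equal t u) h = ≡-image (evalTerm-image h t) (evalTerm-image h u)
    Sat-invariant falsum h = ⇔.refl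
    Sat-invariant (neg ψ) h = ¬-cong-⇔ (Sat-invariant ψ h)
    Sat-invariant (conj ψ χ) h = Sat-invariant ψ h ×-⇔ Sat-invariant χ h
    Sat-invariant (disj ψ χ) h = Sat-invariant ψ h ⊎-⇔ Sat-invariant χ h
    Sat-invariant (exists ψ) {ρ} {ρ′} h = mk⇔
      (λ (c , sat) → σ c , to (Sat-invariant ψ (image-under-binder h c)) sat)
      (λ (c , sat) → σ⁻¹ c ,
        from (Sat-invariant ψ (image-under-binder h (σ⁻¹ c)))
             (subst (λ d → Sat M ψ (maybe ρ′ d)) (sym (σσ⁻¹ c)) sat))
    Sat-invariant (univ ψ) {ρ} {ρ′} h = mk⇔
      (λ sat c → subst (λ d → Sat M ψ (maybe ρ′ d)) (σσ⁻¹ c)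
        (to (Sat-invariant ψ (image-under-binder h (σ⁻¹ c))) (sat (σ⁻¹ c))))
      (λ sat c → from (Sat-invariant ψ (image-under-binder h c)) (sat (σ c)))


EqPattern : {A : Set} {n : ℕ} → (Fin n → A) → (Fin n → A) → Set
EqPattern xs ys = ∀ i j → (xs i ≡ xs j) ⇔ (ys i ≡ ys j)

≡-injective⇔ : {A B : Set} {f : A → B} → Injective _≡_ _≡_ f → ∀ {x y} → (f x ≡ f y) ⇔ (x ≡ y)
≡-injective⇔ f-inj = mk⇔ f-inj (cong _)

EqPattern-map : {A B C : Set} {n : ℕ} {f : A → C} {g : B → C} {xs : Fin n → A} {ys : Fin n → B} →
  Injective _≡_ _≡_ f → Injective _≡_ _≡_ g →
  (∀ i j → (xs i ≡ xs j) ⇔ (ys i ≡ ys j)) → EqPattern (f ∘ xs) (g ∘ ys)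
EqPattern-map f-inj g-inj p i j =
  ⇔.trans (≡-injective⇔ f-inj) (⇔.trans (p i j) (⇔.sym (≡-injective⇔ g-inj)))

module _ {A : Set} (_≟A_ : DecidableEquality A) where

  swap : A → A → A → A
  swap a b x with x ≟A a
  ... | yes _ = b
  ... | no _ with x ≟A b
  ...   | yes _ = a
  ...   | no _ = x

  swap-left : ∀ a b → swap a b a ≡ b
  swap-left a b with a ≟A a
  ... | yes _ = refl
  ... | no a≢a = ⊥-elim (a≢a refl)

  swap-right : ∀ a b → swap a b b ≡ a
  swap-right a b with b ≟A a
  ... | yes b≡a = b≡a
  ... | no _ with b ≟A b
  ...   | yes _ = refl
  ...   | no b≢b = ⊥-elim (b≢b refl)

  swap-other : ∀ a b x → x ≢ a → x ≢ b → swap a b x ≡ x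
  swap-other a b x x≢a x≢b with x ≟A a
  ... | yes x≡a = ⊥-elim (x≢a x≡a)
  ... | no _ with x ≟A b
  ...   | yes x≡b = ⊥-elim (x≢b x≡b)
  ...   | no _ = refl

  swap-involutive : ∀ a b x → swap a b (swap a b x) ≡ x
  swap-involutive a b x with x ≟A a
  ... | yes refl = swap-right x b
  ... | no x≢a with x ≟A b
  ...   | yes refl = swap-left a x
  ...   | no x≢b = swap-other a b x x≢a x≢b

  transposition : A → A → A ↔ A
  transposition a b = mk↔ₛ′ (swap a b) (swap a b) (swap-involutive a b) (swap-involutive a b)

  -- Induction on
  -- n: extend the tail, then, if xs 0 is new, correct the image of xs 0 by a
  -- transposition, which fixes the images ys (suc i) of the tail.
  extend-to-permutation : ∀ {n} (xs ys : Fin n → A) → EqPattern xs ys →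
    Σ (A ↔ A) λ π → ∀ i → Inverse.to π (xs i) ≡ ys i
  extend-to-permutation {zero} xs ys same = ↔-refl , λ ()
  extend-to-permutation {suc n} xs ys same
    with extend-to-permutation (xs ∘ suc) (ys ∘ suc) (λ i j → same (suc i) (suc j))
       | any? (λ j → xs zero ≟A xs (suc j))
  ... | π , π-ok | yes (j , x₀≡xⱼ) = π , λ
    { zero → trans (cong (Inverse.to π) x₀≡xⱼ) (trans (π-ok j) (sym (to (same zero (suc j)) x₀≡xⱼ)))
    ; (suc i) → π-ok i }
  ... | π , π-ok | no x₀-new = ↔-trans π (transposition p₀ (ys zero)) , λ
    { zero → swap-left p₀ (ys zero)
    ; (suc i) → trans (cong (swap p₀ (ys zero)) (π-ok i))
        (swap-other p₀ (ys zero) (ys (suc i))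
          (λ yᵢ≡p₀ → x₀-new (i , sym (↔-injective π (trans (π-ok i) yᵢ≡p₀))))
          (λ yᵢ≡y₀ → x₀-new (i , from (same zero (suc i)) (sym yᵢ≡y₀)))) }
    where p₀ = Inverse.to π (xs zero)


data Ternary : ℕ → Set where
  maps : Ternary 3

graphSignature : Signature
graphSignature = record { Func = λ _ → ⊥ ; Rel = Ternary }

module GraphStructure {K V : Set} (_≟K_ : DecidableEquality K) where

  Graph : Set
  Graph = List (K × V)

  lookup : Graph → K → Maybe V
  lookup [] k = nothing
  lookup ((k′ , v) ∷ γ) k with k ≟K k′
  ... | yes _ = just v
  ... | no _ = lookup γ k

  data Element : Set where
    key : K → Element
    val : V → Element
    graph : Graph → Element

  Maps : Element → Element → Element → Set
  Maps (graph γ) (key k) (val v) = lookup γ k ≡ just v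
  Maps _ _ _ = ⊥

  interpret : ∀ {k} → Ternary k → (Fin k → Element) → Set
  interpret maps xs = Maps (xs zero) (xs (suc zero)) (xs (suc (suc zero)))

  structure : Structure graphSignature
  structure = record { Carrier = Element ; funI = λ () ; relI = interpret }

  Maps-functional : ∀ g k v v′ → Maps g (key k) (val v) → Maps g (key k) (val v′) → v ≡ v′
  Maps-functional (graph γ) k v v′ γk≡v γk≡v′ = just-injective (trans (sym γk≡v) γk≡v′)

  graphOn : (K → V) → List K → Graph
  graphOn F = map (λ k → k , F k)

  lookup-graphOn : ∀ (F : K → V) {k ks} → k ∈ ks → lookup (graphOn F ks) k ≡ just (F k)
  lookup-graphOn F {k} (here refl) with k ≟K k
  ... | yes _ = refl
  ... | no k≢k = ⊥-elim (k≢k refl)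
  lookup-graphOn F {k} {k′ ∷ _} (there k∈ks) with k ≟K k′
  ... | yes refl = refl
  ... | no _ = lookup-graphOn F k∈ks

  relabel : (K → K) → (V → V) → Element → Element
  relabel f g (key k) = key (f k)
  relabel f g (val v) = val (g v)
  relabel f g (graph γ) = graph (map (Product.map f g) γ)

  relabel-inverse : ∀ {f f′ : K → K} {g g′ : V → V} →
    (∀ k → f′ (f k) ≡ k) → (∀ v → g′ (g v) ≡ v) → ∀ e → relabel f′ g′ (relabel f g e) ≡ e
  relabel-inverse f′f g′g (key k) = cong key (f′f k)
  relabel-inverse f′f g′g (val v) = cong val (g′g v)
  relabel-inverse {f} {f′} {g} {g′} f′f g′g (graph γ) = cong graph (begin
    map (Product.map f′ g′) (map (Product.map f g) γ) ≡⟨ List.map-∘ γ ⟨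
    map (Product.map f′ g′ ∘ Product.map f g) γ       ≡⟨ List.map-cong (λ (k , v) → cong₂ _,_ (f′f k) (g′g v)) γ ⟩
    map id γ                                          ≡⟨ List.map-id γ ⟩
    γ                                                 ∎)
    where open ≡-Reasoning

  lookup-relabel : ∀ {f : K → K} (g : V → V) → Injective _≡_ _≡_ f → ∀ γ k →
    lookup (map (Product.map f g) γ) (f k) ≡ Maybe.map g (lookup γ k)
  lookup-relabel g f-inj [] k = refl
  lookup-relabel {f} g f-inj ((k′ , v) ∷ γ) k with k ≟K k′ | f k ≟K f k′
  ... | yes _ | yes _ = refl
  ... | yes k≡k′ | no fk≢fk′ = ⊥-elim (fk≢fk′ (cong f k≡k′))
  ... | no k≢k′ | yes fk≡fk′ = ⊥-elim (k≢k′ (f-inj fk≡fk′))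
  ... | no _ | no _ = lookup-relabel g f-inj γ k

  relabel-↔ : K ↔ K → V ↔ V → Element ↔ Element
  relabel-↔ π τ = mk↔ₛ′ (relabel (Inverse.to π) (Inverse.to τ)) (relabel (Inverse.from π) (Inverse.from τ))
    (relabel-inverse (Inverse.strictlyInverseˡ π) (Inverse.strictlyInverseˡ τ))
    (relabel-inverse (Inverse.strictlyInverseʳ π) (Inverse.strictlyInverseʳ τ))

  relabel-automorphism : (π : K ↔ K) (τ : V ↔ V) → IsAutomorphism structure (relabel-↔ π τ)
  relabel-automorphism π τ = record { preserves-fun = λ () ; preserves-rel = preserves-Maps }
    where
    σ : Element → Element
    σ = relabel (Inverse.to π) (Inverse.to τ)

    Maps-relabel : ∀ x y z → Maps x y z ⇔ Maps (σ x) (σ y) (σ z)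
    Maps-relabel (graph γ) (key k) (val v) = mk⇔
      (λ γk≡v → trans (lookup-relabel _ (↔-injective π) γ k) (cong (Maybe.map _) γk≡v))
      (λ e → Maybeₚ.map-injective (↔-injective τ) (trans (sym (lookup-relabel _ (↔-injective π) γ k)) e))
    Maps-relabel (graph _) (key _) (key _) = mk⇔ (λ ()) (λ ())
    Maps-relabel (graph _) (key _) (graph _) = mk⇔ (λ ()) (λ ())
    Maps-relabel (graph _) (val _) _ = mk⇔ (λ ()) (λ ())
    Maps-relabel (graph _) (graph _) _ = mk⇔ (λ ()) (λ ())
    Maps-relabel (key _) _ _ = mk⇔ (λ ()) (λ ())
    Maps-relabel (val _) _ _ = mk⇔ (λ ()) (λ ())

    preserves-Maps : ∀ {k} (r : Ternary k) (xs ys : Fin k → Element) →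
      (∀ i → ys i ≡ σ (xs i)) → interpret r xs ⇔ interpret r ys
    preserves-Maps maps xs ys ys≡σxs
      rewrite ys≡σxs zero | ys≡σxs (suc zero) | ys≡σxs (suc (suc zero)) = Maps-relabel _ _ _


-- dropLast x η : the list x ∷ η without its last element
dropLast : ℕ → Tree → Tree
dropLast x [] = []
dropLast x (y ∷ η) = x ∷ dropLast y η

parent : Tree → Maybe Tree
parent [] = nothing
parent (x ∷ η) = just (dropLast x η)

parent-∷ʳ : ∀ ν t → parent (ν ∷ʳ t) ≡ just ν
parent-∷ʳ [] t = refl
parent-∷ʳ (x ∷ ν) t = cong just (dropLast-∷ʳ x ν)
  where
  dropLast-∷ʳ : ∀ x η → dropLast x (η ∷ʳ t) ≡ x ∷ η
  dropLast-∷ʳ x [] = refl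
  dropLast-∷ʳ x (y ∷ η) = cong (x ∷_) (dropLast-∷ʳ y η)

childDepth : Maybe Tree → ℕ
childDepth nothing = 0
childDepth (just ν) = suc (length ν)

childDepth-parent : ∀ η → childDepth (parent η) ≡ length η
childDepth-parent [] = refl
childDepth-parent (x ∷ η) = cong suc (length-dropLast x η)
  where
  length-dropLast : ∀ x η → length (dropLast x η) ≡ length η
  length-dropLast x [] = refl
  length-dropLast x (y ∷ η) = cong suc (length-dropLast y η)

-- η and η′ have a common parent iff they have the same length ℓ and their
-- meet has length at least ℓ - 1: a condition on three lengths only.
SameParentLengths : ℕ → ℕ → ℕ → Set
SameParentLengths ℓ ℓ′ ℓ∧ = ℓ ≡ ℓ′ × ℓ ≤ suc ℓ∧

SameParentLengths-cong : ∀ {ℓ ℓ′ ℓ∧ m m′ m∧} → ℓ ≡ m → ℓ′ ≡ m′ → ℓ∧ ≡ m∧ →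
  SameParentLengths ℓ ℓ′ ℓ∧ ⇔ SameParentLengths m m′ m∧
SameParentLengths-cong refl refl refl = ⇔.refl

dropLast-≡⇔ : ∀ x y η η′ → (dropLast x η ≡ dropLast y η′) ⇔
  SameParentLengths (length (x ∷ η)) (length (y ∷ η′)) (length ((x ∷ η) ∧ₜ (y ∷ η′)))
dropLast-≡⇔ x y [] [] = mk⇔ (λ _ → refl , s≤s z≤n) (λ _ → refl)
dropLast-≡⇔ x y [] (_ ∷ _) = mk⇔ (λ ()) (λ ())
dropLast-≡⇔ x y (_ ∷ _) [] = mk⇔ (λ ()) (λ ())
dropLast-≡⇔ x y (x′ ∷ η) (y′ ∷ η′) with x ≟ y
... | no x≢y = mk⇔ (λ e → ⊥-elim (x≢y (∷-injectiveˡ e))) (λ { (_ , s≤s ()) })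
... | yes refl = mk⇔
  (λ e → let (ℓ≡ℓ′ , ℓ≤) = to IH (∷-injectiveʳ e) in cong suc ℓ≡ℓ′ , s≤s ℓ≤)
  (λ { (ℓ≡ℓ′ , s≤s ℓ≤) → cong (x ∷_) (from IH (suc-injective ℓ≡ℓ′ , ℓ≤)) })
  where IH = dropLast-≡⇔ x′ y′ η η′

parent-≡⇔ : ∀ η η′ → (parent η ≡ parent η′) ⇔
  SameParentLengths (length η) (length η′) (length (η ∧ₜ η′))
parent-≡⇔ [] [] = mk⇔ (λ _ → refl , z≤n) (λ _ → refl)
parent-≡⇔ [] (_ ∷ _) = mk⇔ (λ ()) (λ { (() , _) })
parent-≡⇔ (_ ∷ _) [] = mk⇔ (λ ()) (λ { (() , _) })
parent-≡⇔ (x ∷ η) (y ∷ η′) = mk⇔ (to same ∘ just-injective) (cong just ∘ from same)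
  where same = dropLast-≡⇔ x y η η′

-- The qf L_s-type of a tuple fixes the lengths of all meets of its entries,
-- hence, by parent-≡⇔, the equality pattern of their parents.
length-preserved : ∀ {n} {η ν : Fin n → Tree} → SameQF-s η ν →
  ∀ t → length (evalT η t) ≡ length (evalT ν t)
length-preserved {η = η} same t =
  sym (to (proj₂ (proj₂ (proj₂ (same t t))) (length (evalT η t))) refl)

parent-pattern : ∀ {n} {η ν : Fin n → Tree} → SameQF-s η ν → EqPattern (parent ∘ η) (parent ∘ ν)
parent-pattern {η = η} {ν} same i j =
  ⇔.trans (parent-≡⇔ (η i) (η j))
    (⇔.trans (SameParentLengths-cong (ℓ (tvar i)) (ℓ (tvar j)) (ℓ (tmeet (tvar i) (tvar j))))
      (⇔.sym (parent-≡⇔ (ν i) (ν j))))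
  where ℓ = length-preserved same

eq-pattern : ∀ s′ {n} {η ν : Fin n → Tree} → SameQF s′ η ν → EqPattern η ν
eq-pattern s same i j = proj₁ (same (tvar i) (tvar j))
eq-pattern str same i j = proj₁ (same (tvar i) (tvar j))


dbl : Tree → Tree
dbl [] = []
dbl (x ∷ η) = x ∷ 0 ∷ dbl η

dbl-∧ : ∀ η η′ → dbl (η ∧ₜ η′) ≡ dbl η ∧ₜ dbl η′
dbl-∧ [] η′ = refl
dbl-∧ (x ∷ η) [] = refl
dbl-∧ (x ∷ η) (y ∷ η′) with x ≟ y
... | yes refl = cong (λ ζ → x ∷ 0 ∷ ζ) (dbl-∧ η η′)
... | no _ = refl

dbl-⊴ : ∀ η η′ → (η ⊴ η′) ⇔ (dbl η ⊴ dbl η′)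
dbl-⊴ η η′ = mk⇔ (forward η η′) (backward η η′)
  where
  forward : ∀ η η′ → η ⊴ η′ → dbl η ⊴ dbl η′
  forward [] η′ []⊴ = []⊴
  forward (x ∷ η) (x ∷ η′) (∷⊴ η⊴η′) = ∷⊴ (∷⊴ (forward η η′ η⊴η′))
  backward : ∀ η η′ → dbl η ⊴ dbl η′ → η ⊴ η′
  backward [] η′ _ = []⊴
  backward (x ∷ η) (x ∷ η′) (∷⊴ (∷⊴ p)) = ∷⊴ (backward η η′ p)

dbl-<lex : ∀ η η′ → (η <lex η′) ⇔ (dbl η <lex dbl η′)
dbl-<lex η η′ = mk⇔ (forward η η′) (backward η η′)
  where
  forward : ∀ η η′ → η <lex η′ → dbl η <lex dbl η′
  forward [] (y ∷ η′) []< = []<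
  forward (x ∷ η) (y ∷ η′) (hd< x<y) = hd< x<y
  forward (x ∷ η) (x ∷ η′) (tl< p) = tl< (tl< (forward η η′ p))
  backward : ∀ η η′ → dbl η <lex dbl η′ → η <lex η′
  backward [] (y ∷ η′) _ = []<
  backward (x ∷ η) (y ∷ η′) (hd< x<y) = hd< x<y
  backward (x ∷ η) (x ∷ η′) (tl< (tl< p)) = tl< (backward η η′ p)

length-dbl : ∀ η → length (dbl η) ≡ 2 * length η
length-dbl [] = refl
length-dbl (x ∷ η) = trans (cong (λ ℓ → suc (suc ℓ)) (length-dbl η)) (sym (*-suc 2 (length η)))

dbl-<len : ∀ η η′ → (length η < length η′) ⇔ (length (dbl η) < length (dbl η′))
dbl-<len η η′ rewrite length-dbl η | length-dbl η′ = mk⇔ (*-monoʳ-< 2) (*-cancelˡ-< 2 _ _)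

dbl-injective : Injective _≡_ _≡_ dbl
dbl-injective {[]} {[]} _ = refl
dbl-injective {x ∷ η} {y ∷ η′} e =
  cong₂ _∷_ (∷-injectiveˡ e) (dbl-injective (∷-injectiveʳ (∷-injectiveʳ e)))

-- The last entry of dbl η is a padding 0, so the parent of dbl η still
-- determines η: unlike parent itself, parent ∘ dbl is injective.
parent-dbl-injective : Injective _≡_ _≡_ (parent ∘ dbl)
parent-dbl-injective {[]} {[]} _ = refl
parent-dbl-injective {x ∷ η} {y ∷ η′} e =
  cong₂ _∷_ (∷-injectiveˡ e′) (dropLast-dbl-injective (∷-injectiveʳ e′))
  where
  e′ = just-injective e
  dropLast-dbl-injective : ∀ {η η′} → dropLast 0 (dbl η) ≡ dropLast 0 (dbl η′) → η ≡ η′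
  dropLast-dbl-injective {[]} {[]} _ = refl
  dropLast-dbl-injective {x ∷ η} {y ∷ η′} e =
    cong₂ _∷_ (∷-injectiveˡ (∷-injectiveʳ e)) (dropLast-dbl-injective (∷-injectiveʳ (∷-injectiveʳ e)))

evalT-dbl : ∀ {n} (η : Fin n → Tree) t → evalT (dbl ∘ η) t ≡ dbl (evalT η t)
evalT-dbl η (tvar i) = refl
evalT-dbl η (tmeet t u) rewrite evalT-dbl η t | evalT-dbl η u = sym (dbl-∧ (evalT η t) (evalT η u))

-- dbl preserves qf L_str-types (but not qf L_s-types: it doubles lengths).
dbl-preserves-str : ∀ {n} (η : Fin n → Tree) → SameQF-str η (dbl ∘ η)
dbl-preserves-str η t u rewrite evalT-dbl η t | evalT-dbl η u =
  ⇔.sym (≡-injective⇔ dbl-injective) , dbl-⊴ _ _ , dbl-<lex _ _ , dbl-<len (evalT η t) (evalT η u)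


_≟Tree_ : DecidableEquality Tree
_≟Tree_ = List.≡-dec _≟_

open GraphStructure {Maybe Tree} {Tree} (Maybeₚ.≡-dec _≟Tree_)

M : Structure graphSignature
M = structure

φ : Formula graphSignature (Fin 1 ⊎ Fin 2)
φ = rel maps args
  where
  args : Fin 3 → Term graphSignature (Fin 1 ⊎ Fin 2)
  args zero = var (inj₁ zero)
  args (suc zero) = var (inj₂ zero)
  args (suc (suc zero)) = var (inj₂ (suc zero))

keyed : (Tree → Maybe Tree) → Family M 2
keyed κ η zero = key (κ η)
keyed κ η (suc zero) = val η

-- Homogeneity: tuples from keyed families whose keys and whose values have
-- the same equality patterns are conjugate, hence satisfy the same formulas.
keyed-homogeneous : ∀ {n} (κ κ′ : Tree → Maybe Tree) (η ν : Fin n → Tree) →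
  EqPattern (κ ∘ η) (κ′ ∘ ν) → EqPattern η ν →
  (ψ : Formula graphSignature (Fin n × Fin 2)) →
  Sat M ψ (tupleVal M (keyed κ) η) ⇔ Sat M ψ (tupleVal M (keyed κ′) ν)
keyed-homogeneous κ κ′ η ν keys values =
  conjugate (extend-to-permutation (Maybeₚ.≡-dec _≟Tree_) (κ ∘ η) (κ′ ∘ ν) keys)
            (extend-to-permutation _≟Tree_ η ν values)
  where
  conjugate : (Σ (Maybe Tree ↔ Maybe Tree) λ π → ∀ i → Inverse.to π (κ (η i)) ≡ κ′ (ν i)) →
              (Σ (Tree ↔ Tree) λ τ → ∀ i → Inverse.to τ (η i) ≡ ν i) →
              ∀ ψ → Sat M ψ (tupleVal M (keyed κ) η) ⇔ Sat M ψ (tupleVal M (keyed κ′) ν)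
  conjugate (π , π-ok) (τ , τ-ok) ψ = Sat-invariant M (relabel-↔ π τ) (relabel-automorphism π τ) ψ
    λ { (i , zero) → cong key (sym (π-ok i)) ; (i , suc zero) → cong val (sym (τ-ok i)) }

a : Family M 2
a = keyed parent

b : Family M 2
b = keyed just

a-indiscernible : Indiscernible M s a
a-indiscernible n η ν same = keyed-homogeneous parent parent η ν (parent-pattern same) (eq-pattern s same)

b-indiscernible : Indiscernible M str b
b-indiscernible n η ν same = keyed-homogeneous just just η ν
  (EqPattern-map just-injective just-injective (eq-pattern str same)) (eq-pattern str same)

-- b_η and a_{dbl η} have the same patterns, since just and parent ∘ dbl are injective.
b-based-on-a : BasedOn M str b a
b-based-on-a n ψ η = dbl ∘ η , dbl-preserves-str η ,
  keyed-homogeneous just parent η (dbl ∘ η)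
    (EqPattern-map just-injective parent-dbl-injective (λ _ _ → ⇔.refl))
    (EqPattern-map (λ e → e) dbl-injective (λ _ _ → ⇔.refl)) ψ

-- Along a branch μ, the graph sending parent (μ↾n) to μ↾n for n ∈ ns is well
-- defined (the parent determines the length); two siblings ν⁀t₀, ν⁀t₁ would
-- force one graph to send the key ν to two different values.
a-witnesses-2TP : WitnessesTP M φ 2 a
a-witnesses-2TP = branch-consistent , siblings-inconsistent
  where
  nodeAt : (ℕ → ℕ) → Maybe Tree → Tree
  nodeAt μ k = restrict M μ (childDepth k)

  nodeAt-parent : ∀ μ n → nodeAt μ (parent (restrict M μ n)) ≡ restrict M μ n
  nodeAt-parent μ n = cong (restrict M μ) (trans (childDepth-parent _) (length-applyUpTo μ n))

  branch-consistent : ∀ μ ns → Σ (Fin 1 → Element) λ x →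
    All.All (λ n → Sat M φ (xyVal M x (a (restrict M μ n)))) ns
  branch-consistent μ ns = (λ _ → graph (graphOn (nodeAt μ) (map (parent ∘ restrict M μ) ns))) ,
    All.tabulate λ {n} n∈ns →
      trans (lookup-graphOn (nodeAt μ) (∈-map⁺ _ n∈ns)) (cong just (nodeAt-parent μ n))

  siblings-inconsistent : ∀ ν (t : Fin 2 → ℕ) → Injective _≡_ _≡_ t →
    ¬ (Σ (Fin 1 → Element) λ x → ∀ j → Sat M φ (xyVal M x (a (ν ∷ʳ t j))))
  siblings-inconsistent ν t t-inj (x , sat) = 0≢1+n (t-inj (∷ʳ-injectiveʳ ν ν
    (Maps-functional (x zero) (just ν) _ _ (parent-is-ν zero) (parent-is-ν (suc zero)))))
    where
    parent-is-ν : ∀ j → Maps (x zero) (key (just ν)) (val (ν ∷ʳ t j))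
    parent-is-ν j = subst (λ k → Maps (x zero) (key k) (val (ν ∷ʳ t j))) (parent-∷ʳ ν (t j)) (sat j)

-- The identity graph on the children of the root realises any sibling set.
b-no-TP : (k′ : ℕ) → ¬ WitnessesTP M φ k′ b
b-no-TP k′ (_ , siblings-inconsistent) = siblings-inconsistent [] toℕ toℕ-injective
  ( (λ _ → graph (graphOn (fromMaybe []) (map (λ j → just (toℕ j ∷ [])) (allFin k′))))
  , λ j → lookup-graphOn (fromMaybe []) (∈-map⁺ _ (∈-allFin j)) )

proposition5p10 : Σ Signature λ L → Σ (Structure L) λ M → Σ ℕ λ m → Σ ℕ λ l →
    Σ (Formula L (Fin m ⊎ Fin l)) λ φ → Σ (Family M l) λ a → Σ (Family M l) λ b →
    Indiscernible M s a × WitnessesTP M φ 2 a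
    × Indiscernible M str b × BasedOn M str b a
    × ((k′ : ℕ) → ¬ WitnessesTP M φ k′ b)
proposition5p10 =
  graphSignature , M , 1 , 2 , φ , a , b ,
  a-indiscernible , a-witnesses-2TP , b-indiscernible , b-based-on-a , b-no-TP
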